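{- For any integers $k\ge0$, $\ell\ge1$, and $b\ge2$, $$S(1^k b^\ell;t,x)=\frac{t^{k+\ell}x^{k+b\ell}}{(1-x)^{k+1}\Big((tx^b)^{\ell-1}\big(1-tx[b-1]_x\big)+(1-x-tx)\sum_{i=0}^{\ell-2}(1-x)^i(tx^b)^{\ell-2-i}\Big)}.$$
   Context: $\mathbb{P}$ is the positive integers; $\mathbb{P}^*$ the finite words over $\mathbb{P}$. Generalized factor order: $u\le w$ iff there is a factor $w'$ of $w$ (consecutive letters) with $|w'|=|u|$ and $u_i\le w'_i$ for all $i$; such $w'$ is an embedding. $\mathcal{S}(u)$ is the set of $w\ge u$ such that every embedding of $u$ into $w$ is a suffix of $w$. The weight of $w=w_1\cdots w_\ell$ is $t^\ell x^{w_1+\cdots+w_\ell}$, and $S(u;t,x)=\sum_{w\in\mathcal{S}(u)}\mathrm{wt}(w)$. $1^kb^\ell$ is the word of $k$ ones followed by $\ell$ copies of $b$. $[m]_x=1+x+\cdots+x^{m-1}$. -}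

module Defs where

open import Data.Nat as ℕ using (ℕ; zero; suc; _+_; _∸_; _≤_)
open import Data.Integer as ℤ using (ℤ; +_; -_)
open import Data.List using (List; []; _∷_; length; take; drop; replicate; _++_)
open import Data.List.Relation.Unary.All using (All)
open import Data.List.Relation.Unary.Unique.Propositional using (Unique)
open import Data.List.Membership.Propositional using (_∈_)
open import Data.List.Relation.Binary.Pointwise using (Pointwise)
open import Data.Product using (Σ; ∃; _×_)
open import Function.Bundles using (_⇔_)
open import Relation.Binary.PropositionalEquality using (_≡_)
open import Relation.Nullary using (yes; no)

Word : Set
Word = List ℕ

Positive : Word → Set
Positive w = All (1 ≤_) w

-- u embeds into w at (0-based) position p: the factor w' = w_{p+1} ⋯ w_{p+|u|}
-- of w exists and u_i ≤ w'_i for all i.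
EmbedsAt : Word → Word → ℕ → Set
EmbedsAt u w p = (p + length u ≤ length w) × Pointwise _≤_ u (take (length u) (drop p w))

_≼_ : Word → Word → Set
u ≼ w = ∃ λ p → EmbedsAt u w p

-- w ∈ 𝒮(u): u ≤ w and every embedding of u into w is a suffix of w
InS : Word → Word → Set
InS u w = (u ≼ w) × (∀ p → EmbedsAt u w p → p + length u ≡ length w)

oneKbL : ℕ → ℕ → ℕ → Word
oneKbL k b ℓ = replicate k 1 ++ replicate ℓ b

IsCount : {A : Set} → (A → Set) → ℕ → Set
IsCount {A} P c = Σ (List A) λ L → Unique L × (∀ x → (x ∈ L) ⇔ P x) × length L ≡ c

-- Formal power series in t, x with integer coefficients:
-- f n m is the coefficient of t^n x^m.

Series : Set
Series = ℕ → ℕ → ℤ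

sumTo : ℕ → (ℕ → ℤ) → ℤ
sumTo zero f = f 0
sumTo (suc n) f = sumTo n f ℤ.+ f (suc n)

infixl 6 _⊕_ _⊖_
infixl 7 _⊗_

_⊕_ : Series → Series → Series
(f ⊕ g) n m = f n m ℤ.+ g n m

_⊖_ : Series → Series → Series
(f ⊖ g) n m = f n m ℤ.- g n m

_⊗_ : Series → Series → Series
(f ⊗ g) n m = sumTo n λ i → sumTo m λ j → f i j ℤ.* g (n ∸ i) (m ∸ j)

zeroS : Series
zeroS _ _ = + 0

mono : ℕ → ℕ → Series
mono a b n m with a ℕ.≟ n | b ℕ.≟ m
... | yes _ | yes _ = + 1
... | _ | _ = + 0

oneS tS xS : Series
oneS = mono 0 0
tS = mono 1 0
xS = mono 0 1

_^S_ : Series → ℕ → Series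
f ^S zero = oneS
f ^S suc n = f ⊗ (f ^S n)

sumS : ℕ → (ℕ → Series) → Series
sumS zero f = zeroS
sumS (suc n) f = sumS n f ⊕ f n

qint : ℕ → Series
qint m = sumS m λ j → xS ^S j

denom : ℕ → ℕ → ℕ → Series
denom k ℓ b =
  ((oneS ⊖ xS) ^S (k + 1)) ⊗
    ( (q ^S (ℓ ∸ 1)) ⊗ (oneS ⊖ tS ⊗ xS ⊗ qint (b ∸ 1))
    ⊕ (oneS ⊖ xS ⊖ tS ⊗ xS) ⊗ sumS (ℓ ∸ 1) (λ i → ((oneS ⊖ xS) ^S i) ⊗ (q ^S (ℓ ∸ 2 ∸ i))) )
  where
  q : Series
  q = tS ⊗ (xS ^S b)

numer : ℕ → ℕ → ℕ → Series
numer k ℓ b = mono (k + ℓ) (k + b ℕ.* ℓ)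

module Submission where

-- After its first k letters, a word of 𝒮(1^k b^ℓ) is read by an automaton whose state r is
-- the number of big letters (≥ b) still missing from a block b^ℓ: a big letter decrements r,
-- a small one resets it to ℓ, and the word must end exactly when r reaches 0. Splitting off
-- the first letter, the generating functions T_r of the states satisfy T_0 = 1 and
-- T_{r+1} = (A - B) T_ℓ + B T_r, and the whole series is U_k = A^k T_ℓ, where A and B are the
-- series of all letters and of big letters. Multiplying by 1 - x turns A and B into tx and
-- tx^b, and unfolding the recurrence ℓ times solves for T_ℓ.

open import Algebra using (CommutativeRing)
open import Data.Bool using (Bool; true; false; if_then_else_; T)
open import Data.Integer as ℤ using (ℤ; +_; -[1+_])
import Data.Integer.Properties as ℤ
open import Data.List using (List; []; _∷_; length; _++_; map; replicate; [_])
import Data.List.Properties as List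
open import Data.Nat as ℕ using (ℕ; zero; suc; _∸_; _≤_; _<_; z≤n; s≤s; _≤ᵇ_; _<ᵇ_)
import Data.Nat.Properties as ℕ
open import Data.Nat.ListAction using (sum)
open import Data.Product using (Σ-syntax; _×_; _,_)
open import Function.Bundles using (_⇔_; mk⇔; Equivalence)
import Function.Properties.Equivalence as ⇔
open import Relation.Binary.PropositionalEquality as ≡ using (_≡_; _≢_)
open import Relation.Nullary using (¬_; yes; no; contradiction)
open import Defs


module IntegerRingSolver {c ℓ} (R : CommutativeRing c ℓ) where
  import Data.Sign as Sign
  open import Data.Maybe using (Maybe; just; nothing)
  open import Algebra.Solver.Ring.AlmostCommutativeRing using (fromCommutativeRing; _-Raw-AlmostCommutative⟶_)

  open CommutativeRing R
  open import Algebra.Properties.Semiring.Mult.TCOptimised semiring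
    using (1+×; ×-homo-+; ×1-homo-*) renaming (_×_ to _·_)
  open import Algebra.Properties.Ring ring using (-‿distribˡ-*; -‿distribʳ-*; -‿involutive; -0#≈0#; -‿+-comm)
  open import Relation.Binary.Reasoning.Setoid setoid

  ι : ℤ → Carrier
  ι (+ n) = n · 1#
  ι -[1+ n ] = - (suc n · 1#)

  private
    x-0≈x : ∀ x → x - 0# ≈ x
    x-0≈x x = trans (+-congˡ -0#≈0#) (+-identityʳ x)

    1+-cancel : ∀ x y → (1# + x) - (1# + y) ≈ x - y
    1+-cancel x y = begin
      (1# + x) - (1# + y)     ≈⟨ +-congˡ (-‿+-comm 1# y) ⟨
      (1# + x) + (- 1# - y)   ≈⟨ +-assoc 1# x _ ⟩
      1# + (x + (- 1# - y))   ≈⟨ +-congˡ (trans (+-congˡ (+-comm _ _)) (sym (+-assoc x _ _))) ⟩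
      1# + ((x - y) - 1#)     ≈⟨ +-comm 1# _ ⟩
      ((x - y) - 1#) + 1#     ≈⟨ +-assoc _ _ _ ⟩
      (x - y) + (- 1# + 1#)   ≈⟨ +-congˡ (-‿inverseˡ 1#) ⟩
      (x - y) + 0#            ≈⟨ +-identityʳ _ ⟩
      x - y                   ∎

  ι-⊖ : ∀ m n → ι (m ℤ.⊖ n) ≈ m · 1# - n · 1#
  ι-⊖ zero zero = sym (x-0≈x _)
  ι-⊖ zero (suc n) = sym (+-identityˡ _)
  ι-⊖ (suc m) zero = sym (x-0≈x _)
  ι-⊖ (suc m) (suc n) = begin
    ι (suc m ℤ.⊖ suc n)       ≡⟨ ≡.cong ι (ℤ.[1+m]⊖[1+n]≡m⊖n m n) ⟩
    ι (m ℤ.⊖ n)               ≈⟨ ι-⊖ m n ⟩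
    m · 1# - n · 1#                   ≈⟨ 1+-cancel _ _ ⟨
    (1# + m · 1#) - (1# + n · 1#)     ≈⟨ +-cong (1+× m 1#) (-‿cong (1+× n 1#)) ⟨
    suc m · 1# - suc n · 1#           ∎

  ι-+ : ∀ i j → ι (i ℤ.+ j) ≈ ι i + ι j
  ι-+ (+ m) (+ n) = ×-homo-+ 1# m n
  ι-+ (+ m) -[1+ n ] = ι-⊖ m (suc n)
  ι-+ -[1+ m ] (+ n) = trans (ι-⊖ n (suc m)) (+-comm _ _)
  ι-+ -[1+ m ] -[1+ n ] = begin
    - (suc (suc (m ℕ.+ n)) · 1#)        ≡⟨ ≡.cong (λ k → - (suc k · 1#)) (ℕ.+-suc m n) ⟨
    - ((suc m ℕ.+ suc n) · 1#)          ≈⟨ -‿cong (×-homo-+ 1# (suc m) (suc n)) ⟩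
    - (suc m · 1# + suc n · 1#)         ≈⟨ -‿+-comm _ _ ⟨
    - (suc m · 1#) - suc n · 1#         ∎

  ι-neg : ∀ i → ι (ℤ.- i) ≈ - ι i
  ι-neg (+ zero) = sym -0#≈0#
  ι-neg (+ suc n) = refl
  ι-neg -[1+ n ] = sym (-‿involutive _)

  private
    ι-◃⁻ : ∀ n → ι (Sign.- ℤ.◃ n) ≈ - (n · 1#)
    ι-◃⁻ zero = sym -0#≈0#
    ι-◃⁻ (suc n) = refl

    ι-◃⁺ : ∀ n → ι (Sign.+ ℤ.◃ n) ≈ n · 1#
    ι-◃⁺ zero = refl
    ι-◃⁺ (suc n) = refl

  ι-* : ∀ i j → ι (i ℤ.* j) ≈ ι i * ι j
  ι-* (+ m) (+ n) = trans (ι-◃⁺ (m ℕ.* n)) (×1-homo-* m n)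
  ι-* (+ m) -[1+ n ] =
    trans (ι-◃⁻ (m ℕ.* suc n)) (trans (-‿cong (×1-homo-* m (suc n))) (-‿distribʳ-* _ _))
  ι-* -[1+ m ] (+ n) =
    trans (ι-◃⁻ (suc m ℕ.* n)) (trans (-‿cong (×1-homo-* (suc m) n)) (-‿distribˡ-* _ _))
  ι-* -[1+ m ] -[1+ n ] = begin
    ι (Sign.+ ℤ.◃ (suc m ℕ.* suc n))         ≈⟨ ι-◃⁺ (suc m ℕ.* suc n) ⟩
    (suc m ℕ.* suc n) · 1#                    ≈⟨ ×1-homo-* (suc m) (suc n) ⟩
    (suc m · 1#) * (suc n · 1#)               ≈⟨ -‿involutive _ ⟨
    - - ((suc m · 1#) * (suc n · 1#))         ≈⟨ -‿cong (-‿distribˡ-* _ _) ⟩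
    - (- (suc m · 1#) * (suc n · 1#))         ≈⟨ -‿distribʳ-* _ _ ⟩
    - (suc m · 1#) * - (suc n · 1#)           ∎

  ι-morphism : ℤ.+-*-rawRing -Raw-AlmostCommutative⟶ fromCommutativeRing R
  ι-morphism = record
    { ⟦_⟧ = ι ; +-homo = ι-+ ; *-homo = ι-* ; -‿homo = ι-neg ; 0-homo = refl ; 1-homo = refl }

  ι-≟ : (i j : ℤ) → Maybe (ι i ≈ ι j)
  ι-≟ i j with i ℤ.≟ j
  ... | yes ≡.refl = just refl
  ... | no _ = nothing

  open import Algebra.Solver.Ring ℤ.+-*-rawRing (fromCommutativeRing R) ι-morphism ι-≟ public

  :0 :1 : ∀ {n} → Polynomial n
  :0 = con (+ 0)
  :1 = con (+ 1)


module PowerSeries {c ℓ} (R : CommutativeRing c ℓ) where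
  open CommutativeRing R
  open IntegerRingSolver R using (solve; _:=_; _:+_; _:*_)
  open import Relation.Binary.Reasoning.Setoid setoid

  ∑≤ : ℕ → (ℕ → Carrier) → Carrier
  ∑≤ zero f = f 0
  ∑≤ (suc n) f = ∑≤ n f + f (suc n)

  ∑≤-cong : ∀ n {f g} → (∀ i → i ≤ n → f i ≈ g i) → ∑≤ n f ≈ ∑≤ n g
  ∑≤-cong zero f≈g = f≈g 0 z≤n
  ∑≤-cong (suc n) f≈g = +-cong (∑≤-cong n (λ i i≤n → f≈g i (ℕ.m≤n⇒m≤1+n i≤n))) (f≈g (suc n) ℕ.≤-refl)

  ∑≤-suc : ∀ n f → ∑≤ (suc n) f ≈ f 0 + ∑≤ n (λ i → f (suc i))
  ∑≤-suc zero f = refl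
  ∑≤-suc (suc n) f = trans (+-congʳ (∑≤-suc n f)) (+-assoc _ _ _)

  ∑≤-+ : ∀ n f g → ∑≤ n (λ i → f i + g i) ≈ ∑≤ n f + ∑≤ n g
  ∑≤-+ zero f g = refl
  ∑≤-+ (suc n) f g = trans (+-congʳ (∑≤-+ n f g))
    (solve 4 (λ a b c d → (a :+ b) :+ (c :+ d) := (a :+ c) :+ (b :+ d)) refl
             (∑≤ n f) (∑≤ n g) (f (suc n)) (g (suc n)))

  *-∑≤ : ∀ n a f → a * ∑≤ n f ≈ ∑≤ n (λ i → a * f i)
  *-∑≤ zero a f = refl
  *-∑≤ (suc n) a f = trans (distribˡ _ _ _) (+-congʳ (*-∑≤ n a f))

  ∑≤-zero : ∀ n {f} → (∀ i → i ≤ n → f i ≈ 0#) → ∑≤ n f ≈ 0#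
  ∑≤-zero zero f≈0 = f≈0 0 z≤n
  ∑≤-zero (suc n) f≈0 =
    trans (+-cong (∑≤-zero n (λ i i≤n → f≈0 i (ℕ.m≤n⇒m≤1+n i≤n))) (f≈0 (suc n) ℕ.≤-refl)) (+-identityʳ 0#)

  ∑≤-single : ∀ n a {f} → a ≤ n → (∀ i → i ≤ n → i ≢ a → f i ≈ 0#) → ∑≤ n f ≈ f a
  ∑≤-single zero .0 z≤n _ = refl
  ∑≤-single (suc n) a {f} a≤1+n f≈0 with a ℕ.≟ suc n
  ... | yes ≡.refl = trans (+-congʳ (∑≤-zero n λ i i≤n → f≈0 i (ℕ.m≤n⇒m≤1+n i≤n) (ℕ.<⇒≢ (s≤s i≤n)))) (+-identityˡ _)
  ... | no a≢1+n = trans (+-cong (∑≤-single n a (ℕ.≤-pred (ℕ.≤∧≢⇒< a≤1+n a≢1+n)) λ i i≤n → f≈0 i (ℕ.m≤n⇒m≤1+n i≤n))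
                                 (f≈0 (suc n) ℕ.≤-refl (≡.≢-sym a≢1+n)))
                         (+-identityʳ _)

  PS : Set c
  PS = ℕ → Carrier

  _≋_ : PS → PS → Set ℓ
  f ≋ g = ∀ n → f n ≈ g n

  infixl 7 _⋆_
  _⋆_ : PS → PS → PS
  (f ⋆ g) n = ∑≤ n (λ i → f i * g (n ∸ i))

  ⋆-suc : ∀ n f g → (f ⋆ g) (suc n) ≈ f 0 * g (suc n) + ((λ i → f (suc i)) ⋆ g) n
  ⋆-suc n f g = ∑≤-suc n (λ i → f i * g (suc n ∸ i))

  ⋆-sucʳ : ∀ n f g → (f ⋆ g) (suc n) ≈ (f ⋆ (λ i → g (suc i))) n + f (suc n) * g 0
  ⋆-sucʳ n f g = +-cong (∑≤-cong n (λ i i≤n → reflexive (≡.cong (λ k → f i * g k) (ℕ.+-∸-assoc 1 i≤n))))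
                        (reflexive (≡.cong (λ k → f (suc n) * g k) (ℕ.n∸n≡0 n)))

  ⋆-cong : ∀ {f f′ g g′} → f ≋ f′ → g ≋ g′ → (f ⋆ g) ≋ (f′ ⋆ g′)
  ⋆-cong f≋f′ g≋g′ n = ∑≤-cong n (λ i _ → *-cong (f≋f′ i) (g≋g′ (n ∸ i)))

  ⋆-comm : ∀ f g → (f ⋆ g) ≋ (g ⋆ f)
  ⋆-comm f g zero = *-comm _ _
  ⋆-comm f g (suc n) = begin
    (f ⋆ g) (suc n)                                    ≈⟨ ⋆-suc n f g ⟩
    f 0 * g (suc n) + ((λ i → f (suc i)) ⋆ g) n        ≈⟨ +-cong (*-comm _ _) (⋆-comm _ g n) ⟩
    g (suc n) * f 0 + (g ⋆ (λ i → f (suc i))) n        ≈⟨ +-comm _ _ ⟩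
    (g ⋆ (λ i → f (suc i))) n + g (suc n) * f 0        ≈⟨ ⋆-sucʳ n g f ⟨
    (g ⋆ f) (suc n)                                    ∎

  ⋆-distribˡ : ∀ f g h → (f ⋆ (λ i → g i + h i)) ≋ (λ n → (f ⋆ g) n + (f ⋆ h) n)
  ⋆-distribˡ f g h n = trans (∑≤-cong n (λ i _ → distribˡ _ _ _)) (∑≤-+ n _ _)

  ⋆-distribʳ : ∀ f g h → ((λ i → g i + h i) ⋆ f) ≋ (λ n → (g ⋆ f) n + (h ⋆ f) n)
  ⋆-distribʳ f g h n = trans (⋆-comm _ f n) (trans (⋆-distribˡ f g h n) (+-cong (⋆-comm f g n) (⋆-comm f h n)))

  ⋆-scalarˡ : ∀ n a f g → ((λ i → a * f i) ⋆ g) n ≈ a * (f ⋆ g) n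
  ⋆-scalarˡ n a f g = trans (∑≤-cong n (λ i _ → *-assoc _ _ _)) (sym (*-∑≤ n a _))

  ⋆-assoc : ∀ f g h → ((f ⋆ g) ⋆ h) ≋ (f ⋆ (g ⋆ h))
  ⋆-assoc f g h zero = *-assoc _ _ _
  ⋆-assoc f g h (suc n) = begin
    ((f ⋆ g) ⋆ h) (suc n)
      ≈⟨ ⋆-suc n (f ⋆ g) h ⟩
    (f 0 * g 0) * h (suc n) + ((λ i → (f ⋆ g) (suc i)) ⋆ h) n
      ≈⟨ +-congˡ (⋆-cong {g = h} (λ i → ⋆-suc i f g) (λ _ → refl) n) ⟩
    (f 0 * g 0) * h (suc n) + ((λ i → f 0 * g (suc i) + (f′ ⋆ g) i) ⋆ h) n
      ≈⟨ +-congˡ (⋆-distribʳ h (λ i → f 0 * g (suc i)) (f′ ⋆ g) n) ⟩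
    (f 0 * g 0) * h (suc n) + (((λ i → f 0 * g (suc i)) ⋆ h) n + ((f′ ⋆ g) ⋆ h) n)
      ≈⟨ +-congˡ (+-cong (⋆-scalarˡ n (f 0) _ h) (⋆-assoc f′ g h n)) ⟩
    (f 0 * g 0) * h (suc n) + (f 0 * ((λ i → g (suc i)) ⋆ h) n + (f′ ⋆ (g ⋆ h)) n)
      ≈⟨ regroup ⟩
    f 0 * (g 0 * h (suc n) + ((λ i → g (suc i)) ⋆ h) n) + (f′ ⋆ (g ⋆ h)) n
      ≈⟨ +-congʳ (*-congˡ (⋆-suc n g h)) ⟨
    f 0 * (g ⋆ h) (suc n) + (f′ ⋆ (g ⋆ h)) n
      ≈⟨ ⋆-suc n f (g ⋆ h) ⟨
    (f ⋆ (g ⋆ h)) (suc n) ∎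
    where
    f′ : PS
    f′ i = f (suc i)
    regroup : ∀ {a b c d e} → (a * b) * c + (a * d + e) ≈ a * (b * c + d) + e
    regroup = solve 5 (λ a b c d e → (a :* b) :* c :+ (a :* d :+ e) := a :* (b :* c :+ d) :+ e) refl _ _ _ _ _

  𝟙 : PS
  𝟙 zero = 1#
  𝟙 (suc _) = 0#

  𝟙-⋆ : ∀ f → (𝟙 ⋆ f) ≋ f
  𝟙-⋆ f zero = *-identityˡ _
  𝟙-⋆ f (suc n) = begin
    (𝟙 ⋆ f) (suc n)                  ≈⟨ ⋆-suc n 𝟙 f ⟩
    1# * f (suc n) + ((λ _ → 0#) ⋆ f) n ≈⟨ +-cong (*-identityˡ _) (∑≤-zero n (λ i _ → zeroˡ _)) ⟩
    f (suc n) + 0#                   ≈⟨ +-identityʳ _ ⟩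
    f (suc n)                        ∎

  powerSeriesRing : CommutativeRing c ℓ
  powerSeriesRing = record
    { Carrier = PS
    ; _≈_ = _≋_
    ; _+_ = λ f g n → f n + g n
    ; _*_ = _⋆_
    ; -_ = λ f n → - f n
    ; 0# = λ _ → 0#
    ; 1# = 𝟙
    ; isCommutativeRing = record
      { isRing = record
        { +-isAbelianGroup = record
          { isGroup = record
            { isMonoid = record
              { isSemigroup = record
                { isMagma = record
                  { isEquivalence = record
                    { refl = λ _ → refl ; sym = λ f≋g n → sym (f≋g n) ; trans = λ f≋g g≋h n → trans (f≋g n) (g≋h n) }
                  ; ∙-cong = λ f≋f′ g≋g′ n → +-cong (f≋f′ n) (g≋g′ n) }
                ; assoc = λ _ _ _ _ → +-assoc _ _ _ }
              ; identity = (λ _ _ → +-identityˡ _) , (λ _ _ → +-identityʳ _) }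
            ; inverse = (λ _ _ → -‿inverseˡ _) , (λ _ _ → -‿inverseʳ _)
            ; ⁻¹-cong = λ f≋g n → -‿cong (f≋g n) }
          ; comm = λ _ _ _ → +-comm _ _ }
        ; *-cong = ⋆-cong
        ; *-assoc = ⋆-assoc
        ; *-identity = 𝟙-⋆ , (λ f n → trans (⋆-comm f 𝟙 n) (𝟙-⋆ f n))
        ; distrib = ⋆-distribˡ , ⋆-distribʳ }
      ; *-comm = ⋆-comm } }


module RingRecurrences {c ℓ} (R : CommutativeRing c ℓ) where
  open CommutativeRing R
  open import Algebra.Properties.Semiring.Exp semiring using (_^_)
  open IntegerRingSolver R using (solve; _:=_; _:+_; _:-_; _:*_; :0; :1)
  open import Relation.Binary.Reasoning.Setoid setoid

  ∑< : ℕ → (ℕ → Carrier) → Carrier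
  ∑< zero f = 0#
  ∑< (suc n) f = ∑< n f + f n

  ∑<-cong : ∀ n {f g} → (∀ i → i < n → f i ≈ g i) → ∑< n f ≈ ∑< n g
  ∑<-cong zero f≈g = refl
  ∑<-cong (suc n) f≈g = +-cong (∑<-cong n (λ i i<n → f≈g i (ℕ.m≤n⇒m≤1+n i<n))) (f≈g n ℕ.≤-refl)

  *-∑< : ∀ n a f → a * ∑< n f ≈ ∑< n (λ i → a * f i)
  *-∑< zero a f = zeroʳ a
  *-∑< (suc n) a f = trans (distribˡ _ _ _) (+-congʳ (*-∑< n a f))

  homogeneous : Carrier → Carrier → ℕ → Carrier
  homogeneous y q zero = 0#
  homogeneous y q (suc n) = q * homogeneous y q n + y ^ n

  homogeneous-∑< : ∀ y q n → homogeneous y q n ≈ ∑< n (λ i → y ^ i * q ^ (n ∸ 1 ∸ i))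
  homogeneous-∑< y q zero = refl
  homogeneous-∑< y q (suc n) = begin
    q * homogeneous y q n + y ^ n                            ≈⟨ +-congʳ (*-congˡ (homogeneous-∑< y q n)) ⟩
    q * ∑< n (λ i → y ^ i * q ^ (n ∸ 1 ∸ i)) + y ^ n        ≈⟨ +-cong (trans (*-∑< n q _) (∑<-cong n shift)) last ⟩
    ∑< (suc n) (λ i → y ^ i * q ^ (n ∸ i))                   ∎
    where
    shift : ∀ i → i < n → q * (y ^ i * q ^ (n ∸ 1 ∸ i)) ≈ y ^ i * q ^ (n ∸ i)
    shift i (s≤s i≤n-1) = trans (x∙yz≈y∙xz q _ _)
      (*-congˡ (reflexive (≡.cong (q ^_) (≡.sym (ℕ.+-∸-assoc 1 i≤n-1)))))
      where open import Algebra.Properties.CommutativeSemigroup *-commutativeSemigroup using (x∙yz≈y∙xz)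
    last : y ^ n ≈ y ^ n * q ^ (n ∸ n)
    last = sym (trans (*-congˡ (reflexive (≡.cong (q ^_) (ℕ.n∸n≡0 n)))) (*-identityʳ _))

  ^-difference : ∀ y q n → y ^ n ≈ q ^ n + (y - q) * homogeneous y q n
  ^-difference y q zero = solve 2 (λ y q → :1 := :1 :+ (y :- q) :* :0) refl y q
  ^-difference y q (suc n) = begin
    y * y ^ n
      ≈⟨ *-congˡ (^-difference y q n) ⟩
    y * (q ^ n + (y - q) * h)
      ≈⟨ solve 4 (λ y q Q h → y :* (Q :+ (y :- q) :* h) := q :* Q :+ (y :- q) :* (q :* h :+ (Q :+ (y :- q) :* h)))
               refl y q (q ^ n) h ⟩
    q * q ^ n + (y - q) * (q * h + (q ^ n + (y - q) * h))
      ≈⟨ +-congˡ (*-congˡ (+-congˡ (^-difference y q n))) ⟨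
    q * q ^ n + (y - q) * (q * h + y ^ n) ∎
    where h = homogeneous y q n

  unfold-recurrence : ∀ y q a (T : ℕ → Carrier) → (∀ r → y * T (suc r) ≈ a + q * T r) →
                      ∀ n → y ^ n * T n ≈ a * homogeneous y q n + q ^ n * T 0
  unfold-recurrence y q a T rec zero = solve 2 (λ a t → :1 :* t := a :* :0 :+ :1 :* t) refl a (T 0)
  unfold-recurrence y q a T rec (suc n) = begin
    (y * y ^ n) * T (suc n)
      ≈⟨ solve 3 (λ y Y t → (y :* Y) :* t := Y :* (y :* t)) refl y (y ^ n) (T (suc n)) ⟩
    y ^ n * (y * T (suc n))
      ≈⟨ *-congˡ (rec n) ⟩
    y ^ n * (a + q * T n)
      ≈⟨ solve 4 (λ Y a q t → Y :* (a :+ q :* t) := a :* Y :+ q :* (Y :* t)) refl (y ^ n) a q (T n) ⟩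
    a * y ^ n + q * (y ^ n * T n)
      ≈⟨ +-congˡ (*-congˡ (unfold-recurrence y q a T rec n)) ⟩
    a * y ^ n + q * (a * h + q ^ n * T 0)
      ≈⟨ solve 6 (λ a Y q h Q t → a :* Y :+ q :* (a :* h :+ Q :* t) := a :* (q :* h :+ Y) :+ (q :* Q) :* t)
               refl a (y ^ n) q h (q ^ n) (T 0) ⟩
    a * (q * h + y ^ n) + (q * q ^ n) * T 0 ∎
    where h = homogeneous y q n

  ^-recurrence : ∀ y a z (U : ℕ → Carrier) → y * a ≈ z → (∀ k → U (suc k) ≈ a * U k) →
                 ∀ k → y ^ k * U k ≈ z ^ k * U 0
  ^-recurrence y a z U ya≈z rec zero = refl
  ^-recurrence y a z U ya≈z rec (suc k) = begin
    (y * y ^ k) * U (suc k)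
      ≈⟨ *-congˡ (rec k) ⟩
    (y * y ^ k) * (a * U k)
      ≈⟨ solve 4 (λ y Y a u → (y :* Y) :* (a :* u) := (y :* a) :* (Y :* u)) refl y (y ^ k) a (U k) ⟩
    (y * a) * (y ^ k * U k)
      ≈⟨ *-cong ya≈z (^-recurrence y a z U ya≈z rec k) ⟩
    z * (z ^ k * U 0)
      ≈⟨ *-assoc _ _ _ ⟨
    (z * z ^ k) * U 0 ∎

  [1-x]*∑<-^ : ∀ x m → (1# - x) * ∑< m (x ^_) ≈ 1# - x ^ m
  [1-x]*∑<-^ x zero = solve 1 (λ x → (:1 :- x) :* :0 := :1 :- :1) refl x
  [1-x]*∑<-^ x (suc m) = begin
    (1# - x) * (∑< m (x ^_) + x ^ m)
      ≈⟨ solve 3 (λ x S X → (:1 :- x) :* (S :+ X) := (:1 :- x) :* S :+ X :- x :* X) refl x (∑< m (x ^_)) (x ^ m) ⟩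
    (1# - x) * ∑< m (x ^_) + x ^ m - x * x ^ m
      ≈⟨ +-congʳ (+-congʳ ([1-x]*∑<-^ x m)) ⟩
    (1# - x ^ m) + x ^ m - x * x ^ m
      ≈⟨ solve 2 (λ X Y → (:1 :- X) :+ X :- Y := :1 :- Y) refl (x ^ m) (x * x ^ m) ⟩
    1# - x * x ^ m ∎

  module GeneratingFunction (x t : Carrier) (b′ l : ℕ) where
    y q s : Carrier
    y = 1# - x
    q = t * x ^ suc b′
    s = t * x - q

    denominator : Carrier
    denominator = q ^ l * (1# - t * x * ∑< b′ (x ^_)) + (1# - x - t * x) * homogeneous y q l

    y*denominator : y * denominator ≈ y ^ suc l - s * homogeneous y q (suc l)
    y*denominator = begin
      y * denominator
        ≈⟨ solve 6 (λ x t X Q Ql h →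
             (:1 :- x) :* (Ql :* (:1 :- t :* x :* Q) :+ (:1 :- x :- t :* x) :* h)
             := (:1 :- x) :* Ql :- Ql :* t :* x :* ((:1 :- x) :* Q) :+ (:1 :- x) :* (:1 :- x :- t :* x) :* h)
             refl x t (x ^ b′) Q (q ^ l) h ⟩
      y * q ^ l - q ^ l * t * x * (y * Q) + y * (y - t * x) * h
        ≈⟨ +-congʳ (+-congˡ (-‿cong (*-congˡ ([1-x]*∑<-^ x b′)))) ⟩
      y * q ^ l - q ^ l * t * x * (1# - x ^ b′) + y * (y - t * x) * h
        ≈⟨ solve 5 (λ x t X Ql h →
             (:1 :- x) :* Ql :- Ql :* t :* x :* (:1 :- X) :+ (:1 :- x) :* ((:1 :- x) :- t :* x) :* h
             := (:1 :- x) :* (Ql :+ ((:1 :- x) :- t :* (x :* X)) :* h)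
                :- (t :* x :- t :* (x :* X)) :* (t :* (x :* X) :* h :+ (Ql :+ ((:1 :- x) :- t :* (x :* X)) :* h)))
             refl x t (x ^ b′) (q ^ l) h ⟩
      y * (q ^ l + (y - q) * h) - s * (q * h + (q ^ l + (y - q) * h))
        ≈⟨ +-cong (*-congˡ (^-difference y q l)) (-‿cong (*-congˡ (+-congˡ (^-difference y q l)))) ⟨
      y * y ^ l - s * (q * h + y ^ l) ∎
      where
      Q = ∑< b′ (x ^_)
      h = homogeneous y q l

    generating-function-identity :
      ∀ (La Lb : Carrier) (T U : ℕ → Carrier) →
      y * La ≈ t * x → y * Lb ≈ q →
      T 0 ≈ 1# → (∀ r → T (suc r) ≈ (La - Lb) * T (suc l) + Lb * T r) →
      U 0 ≈ T (suc l) → (∀ k → U (suc k) ≈ La * U k) →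
      ∀ k → U k * (y ^ suc k * denominator) ≈ (t * x) ^ k * q ^ suc l
    generating-function-identity La Lb T U yLa yLb T0 Trec U0 Urec k = begin
      U k * ((y * y ^ k) * denominator)
        ≈⟨ solve 4 (λ u y Y D → u :* ((y :* Y) :* D) := (Y :* u) :* (y :* D)) refl (U k) y (y ^ k) denominator ⟩
      (y ^ k * U k) * (y * denominator)
        ≈⟨ *-cong (^-recurrence y La (t * x) U yLa Urec k) y*denominator ⟩
      ((t * x) ^ k * U 0) * (y ^ suc l - s * H)
        ≈⟨ trans (*-assoc _ _ _) (*-congˡ (*-congʳ U0)) ⟩
      (t * x) ^ k * (Tℓ * (y ^ suc l - s * H))
        ≈⟨ *-congˡ determinant ⟩
      (t * x) ^ k * q ^ suc l ∎
      where
      Tℓ = T (suc l)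
      H = homogeneous y q (suc l)
      yT-rec : ∀ r → y * T (suc r) ≈ s * Tℓ + q * T r
      yT-rec r = begin
        y * T (suc r)
          ≈⟨ *-congˡ (Trec r) ⟩
        y * ((La - Lb) * Tℓ + Lb * T r)
          ≈⟨ solve 5 (λ y a b u v → y :* ((a :- b) :* u :+ b :* v) := (y :* a :- y :* b) :* u :+ (y :* b) :* v)
                   refl y La Lb Tℓ (T r) ⟩
        (y * La - y * Lb) * Tℓ + (y * Lb) * T r
          ≈⟨ +-cong (*-congʳ (+-cong yLa (-‿cong yLb))) (*-congʳ yLb) ⟩
        s * Tℓ + q * T r ∎
      determinant : Tℓ * (y ^ suc l - s * H) ≈ q ^ suc l
      determinant = begin
        Tℓ * (y ^ suc l - s * H)
          ≈⟨ solve 4 (λ u Y s h → u :* (Y :- s :* h) := Y :* u :- s :* u :* h) refl Tℓ (y ^ suc l) s H ⟩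
        y ^ suc l * Tℓ - s * Tℓ * H
          ≈⟨ +-congʳ (unfold-recurrence y q (s * Tℓ) T yT-rec (suc l)) ⟩
        s * Tℓ * H + q ^ suc l * T 0 - s * Tℓ * H
          ≈⟨ +-congʳ (+-congˡ (*-congˡ T0)) ⟩
        s * Tℓ * H + q ^ suc l * 1# - s * Tℓ * H
          ≈⟨ solve 2 (λ A Q → A :+ Q :* :1 :- A := Q) refl (s * Tℓ * H) (q ^ suc l) ⟩
        q ^ suc l ∎


module SuffixEmbeddings where
  open import Data.Nat using (_+_)
  open import Data.List.Relation.Unary.All using ([]; _∷_)
  open import Data.List.Relation.Binary.Pointwise using ([]; _∷_)
  open import Relation.Binary.PropositionalEquality using (refl)

  InS-length : ∀ {u w} → InS u w → length u ≤ length w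
  InS-length ((p , p+|u|≤|w| , _) , _) = ℕ.≤-trans (ℕ.m≤n+m _ p) p+|u|≤|w|

  InS-at-start : ∀ {u w} → EmbedsAt u w 0 → InS u w ⇔ (length u ≡ length w)
  InS-at-start {u} {w} e = mk⇔ (λ (_ , suffix) → suffix 0 e) (λ |u|≡|w| → (0 , e) , only-at-start |u|≡|w|)
    where
    only-at-start : length u ≡ length w → ∀ p → EmbedsAt u w p → p + length u ≡ length w
    only-at-start |u|≡|w| p (p+|u|≤|w| , _)
      with ℕ.+-cancelʳ-≤ (length u) p 0 (≡.subst (p + length u ≤_) (≡.sym |u|≡|w|) p+|u|≤|w|)
    ... | z≤n = |u|≡|w|

  InS-skip : ∀ {u a w} → ¬ EmbedsAt u (a ∷ w) 0 → InS u (a ∷ w) ⇔ InS u w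
  InS-skip {u} {a} {w} ¬e = mk⇔ to from
    where
    to : InS u (a ∷ w) → InS u w
    to ((zero , e) , _) = contradiction e ¬e
    to ((suc p , s≤s le , pw) , suffix) =
      (p , le , pw) , λ p′ (le′ , pw′) → ℕ.suc-injective (suffix (suc p′) (s≤s le′ , pw′))
    from : InS u w → InS u (a ∷ w)
    from ((p , le , pw) , suffix) = (suc p , s≤s le , pw) , λ
      { zero e → contradiction e ¬e
      ; (suc p′) (s≤s le′ , pw′) → ≡.cong suc (suffix p′ (le′ , pw′)) }

  EmbedsAt-suc : ∀ {u a w p} → EmbedsAt u (a ∷ w) (suc p) ⇔ EmbedsAt u w p
  EmbedsAt-suc = mk⇔ (λ { (s≤s le , pw) → le , pw }) (λ (le , pw) → s≤s le , pw)

  EmbedsAt-1∷ : ∀ {u a w} p → 1 ≤ a → Positive w → EmbedsAt (1 ∷ u) (a ∷ w) p ⇔ EmbedsAt u w p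
  EmbedsAt-1∷ zero 1≤a _ = mk⇔ (λ { (s≤s le , _ ∷ pw) → le , pw }) (λ (le , pw) → s≤s le , 1≤a ∷ pw)
  EmbedsAt-1∷ {u} {a} {a′ ∷ w} (suc p) _ (1≤a′ ∷ pos) =
    ⇔.trans (EmbedsAt-suc {a = a}) (⇔.trans (EmbedsAt-1∷ p 1≤a′ pos) (⇔.sym (EmbedsAt-suc {a = a′})))
  EmbedsAt-1∷ {u} (suc p) _ [] = mk⇔ (λ { (s≤s le , _) → contradiction le (too-long p (length u)) }) (λ { (() , _) })
    where
    too-long : ∀ m n → ¬ (m + suc n ≤ 0)
    too-long m n le with () ← ≡.subst (_≤ 0) (ℕ.+-suc m n) le

  InS-1∷ : ∀ {u a w} → 1 ≤ a → Positive w → InS (1 ∷ u) (a ∷ w) ⇔ InS u w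
  InS-1∷ {u} {a} {w} 1≤a pos = mk⇔
    (λ ((p , e) , suffix) → (p , to (embeds p) e) , λ p′ e′ →
       ℕ.suc-injective (≡.trans (≡.sym (ℕ.+-suc p′ _)) (suffix p′ (from (embeds p′) e′))))
    (λ ((p , e) , suffix) → (p , from (embeds p) e) , λ p′ e′ →
       ≡.trans (ℕ.+-suc p′ _) (≡.cong suc (suffix p′ (to (embeds p′) e′))))
    where
    open Equivalence
    embeds : ∀ p → EmbedsAt (1 ∷ u) (a ∷ w) p ⇔ EmbedsAt u w p
    embeds p = EmbedsAt-1∷ p 1≤a pos


module BlockAutomaton (b ℓ : ℕ) where
  open import Data.Nat using (_+_)
  open import Data.List.Relation.Unary.All using (All; []; _∷_)
  import Data.List.Relation.Unary.All.Properties as All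
  open import Data.List.Relation.Binary.Pointwise using ([]; _∷_)
  open import Relation.Binary.PropositionalEquality using (refl)
  open import Relation.Nullary.Reflects using (ofʸ; ofⁿ)
  open SuffixEmbeddings

  -- accepts r w: w first supplies the r big letters still missing from a block b^ℓ and then
  -- ends; a small letter restarts the block, so that r becomes ℓ again.
  accepts : ℕ → Word → Bool
  accepts zero [] = true
  accepts zero (_ ∷ _) = false
  accepts (suc r) [] = false
  accepts (suc r) (a ∷ w) = if b ≤ᵇ a then accepts r w else accepts ℓ w

  acceptsAfter : ℕ → Word → Bool
  acceptsAfter zero w = accepts ℓ w
  acceptsAfter (suc k) [] = false
  acceptsAfter (suc k) (_ ∷ w) = acceptsAfter k w

  replicate-embeds : ∀ {pre} v → All (b ≤_) pre → EmbedsAt (replicate (length pre) b) (pre ++ v) 0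
  replicate-embeds v [] = z≤n , []
  replicate-embeds v (b≤c ∷ big) = let (le , pw) = replicate-embeds v big in s≤s le , b≤c ∷ pw

  replicate-blocked : ∀ pre {a v n} → a < b → length pre < n → ¬ EmbedsAt (replicate n b) (pre ++ a ∷ v) 0
  replicate-blocked [] a<b (s≤s _) (_ , b≤a ∷ _) = ℕ.<⇒≱ a<b b≤a
  replicate-blocked (c ∷ pre) a<b (s≤s lt) (s≤s le , _ ∷ pw) = replicate-blocked pre a<b lt (le , pw)

  InS-full-block : ∀ {pre} v → All (b ≤_) pre → length pre ≡ ℓ → InS (replicate ℓ b) (pre ++ v) ⇔ (v ≡ [])
  InS-full-block {pre} v big refl = ⇔.trans (InS-at-start (replicate-embeds v big)) (mk⇔ (to v) λ { refl → from })
    where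
    to : ∀ v → length (replicate (length pre) b) ≡ length (pre ++ v) → v ≡ []
    to [] _ = refl
    to (a ∷ v) eq = contradiction
      (≡.trans (≡.sym (List.length-replicate (length pre))) (≡.trans eq (List.length-++-sucʳ pre a v)))
      (λ eq′ → ℕ.m≢1+m+n (length pre) (≡.trans eq′ (≡.cong suc (List.length-++ pre))))
    from : length (replicate (length pre) b) ≡ length (pre ++ [])
    from = ≡.trans (List.length-replicate (length pre)) (≡.cong length (≡.sym (List.++-identityʳ pre)))

  InS-small-letter : ∀ pre {a v} → a < b → length pre < ℓ → InS (replicate ℓ b) (pre ++ a ∷ v) ⇔ InS (replicate ℓ b) v
  InS-small-letter [] a<b lt = InS-skip (replicate-blocked [] a<b lt)
  InS-small-letter (c ∷ pre) a<b lt =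
    ⇔.trans (InS-skip (replicate-blocked (c ∷ pre) a<b lt)) (InS-small-letter pre a<b (ℕ.<-trans (ℕ.n<1+n _) lt))

  InS-block : ∀ v {pre r} → All (b ≤_) pre → length pre + r ≡ ℓ → InS (replicate ℓ b) (pre ++ v) ⇔ T (accepts r v)
  InS-block [] {pre} {zero} big eq =
    ⇔.trans (InS-full-block [] big (≡.trans (≡.sym (ℕ.+-identityʳ _)) eq)) (mk⇔ _ (λ _ → refl))
  InS-block (a ∷ v) {pre} {zero} big eq =
    ⇔.trans (InS-full-block (a ∷ v) big (≡.trans (≡.sym (ℕ.+-identityʳ _)) eq)) (mk⇔ (λ ()) (λ ()))
  InS-block [] {pre} {suc r} big eq = mk⇔ (λ i → contradiction (InS-length i) too-short) (λ ())
    where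
    too-short : ¬ (length (replicate ℓ b) ≤ length (pre ++ []))
    too-short le = ℕ.<⇒≱
      (≡.subst (_< ℓ) (≡.cong length (≡.sym (List.++-identityʳ pre))) (≡.subst (length pre <_) eq (ℕ.m<m+n _ (s≤s z≤n))))
      (≡.subst (_≤ _) (List.length-replicate ℓ) le)
  InS-block (a ∷ v) {pre} {suc r} big eq with b ≤ᵇ a | ℕ.≤ᵇ-reflects-≤ b a
  ... | true | ofʸ b≤a =
    ≡.subst (λ z → InS (replicate ℓ b) z ⇔ T (accepts r v)) (List.++-assoc pre [ a ] v)
      (InS-block v (All.++⁺ big (b≤a ∷ []))
        (≡.trans (≡.cong (_+ r) (List.length-++ pre)) (≡.trans (ℕ.+-assoc (length pre) 1 r) eq)))
  ... | false | ofⁿ b≰a =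
    ⇔.trans (InS-small-letter pre (ℕ.≰⇒> b≰a) (≡.subst (length pre <_) eq (ℕ.m<m+n _ (s≤s z≤n)))) (InS-block v [] refl)

  InS-oneKbL : ∀ k {w} → Positive w → InS (oneKbL k b ℓ) w ⇔ T (acceptsAfter k w)
  InS-oneKbL zero {w} _ = InS-block w [] refl
  InS-oneKbL (suc k) {[]} _ = mk⇔ (λ i → contradiction (InS-length i) λ ()) (λ ())
  InS-oneKbL (suc k) {a ∷ w} (1≤a ∷ pos) = ⇔.trans (InS-1∷ 1≤a pos) (InS-oneKbL k pos)


module Enumeration where
  open import Data.Nat using (_+_)
  open import Data.List.Membership.Propositional using (_∈_)
  open import Data.List.Membership.Propositional.Properties using (∈-map⁺; ∈-map⁻; ∈-++⁺ˡ; ∈-++⁺ʳ; ∈-++⁻)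
  open import Data.List.Membership.Propositional.Properties.WithK using (unique∧set⇒bag)
  open import Data.List.Relation.Binary.BagAndSetEquality using (∼bag⇒↭)
  open import Data.List.Relation.Binary.Permutation.Propositional.Properties using (↭-length)
  open import Data.List.Relation.Unary.All using ([]; _∷_)
  open import Data.List.Relation.Unary.Any using (here)
  open import Data.List.Relation.Unary.AllPairs using ([]; _∷_)
  open import Data.List.Relation.Unary.Unique.Propositional using (Unique)
  import Data.List.Relation.Unary.Unique.Propositional.Properties as Unique
  open import Data.Sum using (inj₁; inj₂)
  open import Data.Unit using (tt)
  open import Relation.Binary.PropositionalEquality using (refl)

  IsCount-unique : ∀ {A : Set} {P Q : A → Set} {c d} → (∀ x → P x ⇔ Q x) → IsCount P c → IsCount Q d → c ≡ d
  IsCount-unique P⇔Q (L , uL , L⇔P , refl) (L′ , uL′ , L′⇔Q , refl) =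
    ↭-length (∼bag⇒↭ (unique∧set⇒bag uL uL′ λ {x} → ⇔.trans (L⇔P x) (⇔.trans (P⇔Q x) (⇔.sym (L′⇔Q x)))))
    where import Function.Properties.Equivalence as ⇔

  Enumerated : (Word → Bool) → ℕ → ℕ → Word → Set
  Enumerated p n m w = Positive w × T (p w) × length w ≡ n × sum w ≡ m

  mutual
    enum : (Word → Bool) → ℕ → ℕ → List Word
    enum p zero zero = if p [] then [ [] ] else []
    enum p zero (suc m) = []
    enum p (suc n) m = enumUpTo p n m m

    enumUpTo : (Word → Bool) → ℕ → ℕ → ℕ → List Word
    enumUpTo p n m zero = enumHead p n m zero
    enumUpTo p n m (suc j) = enumUpTo p n m j ++ enumHead p n m (suc j)

    enumHead : (Word → Bool) → ℕ → ℕ → ℕ → List Word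
    enumHead p n m zero = []
    enumHead p n m (suc a) = map (suc a ∷_) (enum (λ w → p (suc a ∷ w)) n (m ∸ suc a))

  ∈-enumUpTo⁻ : ∀ p n m j {w} → w ∈ enumUpTo p n m j →
                Σ[ a ∈ ℕ ] Σ[ w′ ∈ Word ] w ≡ suc a ∷ w′ × suc a ≤ j × w′ ∈ enum (λ v → p (suc a ∷ v)) n (m ∸ suc a)
  ∈-enumUpTo⁻ p n m (suc j) w∈ with ∈-++⁻ (enumUpTo p n m j) w∈
  ... | inj₁ w∈ˡ = let (a , w′ , eq , a<j , w′∈) = ∈-enumUpTo⁻ p n m j w∈ˡ in a , w′ , eq , ℕ.m≤n⇒m≤1+n a<j , w′∈
  ... | inj₂ w∈ʳ = let (w′ , w′∈ , eq) = ∈-map⁻ (suc j ∷_) w∈ʳ in j , w′ , eq , ℕ.≤-refl , w′∈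

  ∈-enumUpTo⁺ : ∀ p n m j {a w′} → suc a ≤ j → w′ ∈ enum (λ v → p (suc a ∷ v)) n (m ∸ suc a) →
                suc a ∷ w′ ∈ enumUpTo p n m j
  ∈-enumUpTo⁺ p n m (suc j) {a} a<1+j w′∈ with a ℕ.≟ j
  ... | yes refl = ∈-++⁺ʳ (enumUpTo p n m j) (∈-map⁺ (suc j ∷_) w′∈)
  ... | no a≢j = ∈-++⁺ˡ (∈-enumUpTo⁺ p n m j (ℕ.≤∧≢⇒< (ℕ.≤-pred a<1+j) a≢j) w′∈)

  mutual
    enum-unique : ∀ p n m → Unique (enum p n m)
    enum-unique p zero zero with p []
    ... | true = [] ∷ []
    ... | false = []
    enum-unique p zero (suc m) = []
    enum-unique p (suc n) m = enumUpTo-unique p n m m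

    enumUpTo-unique : ∀ p n m j → Unique (enumUpTo p n m j)
    enumUpTo-unique p n m zero = []
    enumUpTo-unique p n m (suc j) =
      Unique.++⁺ (enumUpTo-unique p n m j) (Unique.map⁺ List.∷-injectiveʳ (enum-unique _ n (m ∸ suc j))) disjoint
      where
      disjoint : ∀ {w} → ¬ (w ∈ enumUpTo p n m j × w ∈ enumHead p n m (suc j))
      disjoint (w∈ˡ , w∈ʳ) with ∈-enumUpTo⁻ p n m j w∈ˡ | ∈-map⁻ (suc j ∷_) w∈ʳ
      ... | (a , _ , refl , a<j , _) | (_ , _ , eq) = ℕ.<-irrefl refl (≡.subst (_≤ j) (List.∷-injectiveˡ eq) a<j)

  ∈-enum⁻ : ∀ p n m {w} → w ∈ enum p n m → Enumerated p n m w
  ∈-enum⁻ p zero zero w∈ with p [] in eq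
  ∈-enum⁻ p zero zero (here refl) | true = [] , ≡.subst T (≡.sym eq) tt , refl , refl
  ∈-enum⁻ p (suc n) m w∈ with ∈-enumUpTo⁻ p n m m w∈
  ... | (a , w′ , refl , a<m , w′∈) with ∈-enum⁻ (λ v → p (suc a ∷ v)) n (m ∸ suc a) w′∈
  ... | (pos , pw , refl , sum≡) = s≤s z≤n ∷ pos , pw , refl , ≡.trans (≡.cong (suc a ℕ.+_) sum≡) (ℕ.m+[n∸m]≡n a<m)

  ∈-enum⁺ : ∀ p n m {w} → Enumerated p n m w → w ∈ enum p n m
  ∈-enum⁺ p zero zero {[]} (_ , pw , _ , _) with p []
  ... | true = here refl
  ∈-enum⁺ p (suc n) m {suc a ∷ w} (_ ∷ pos , pw , len , refl) =
    ∈-enumUpTo⁺ p n (suc a + sum w) (suc a + sum w) (ℕ.m≤m+n (suc a) (sum w))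
      (∈-enum⁺ (λ v → p (suc a ∷ v)) n _ (pos , pw , ℕ.suc-injective len , ≡.sym (ℕ.m+n∸m≡n (suc a) (sum w))))

  enum-isCount : ∀ p n m → IsCount (Enumerated p n m) (length (enum p n m))
  enum-isCount p n m = enum p n m , enum-unique p n m , (λ w → mk⇔ (∈-enum⁻ p n m) (∈-enum⁺ p n m)) , refl

  mutual
    enum-cong : ∀ {p p′} → (∀ w → p w ≡ p′ w) → ∀ n m → enum p n m ≡ enum p′ n m
    enum-cong p≗p′ zero zero = ≡.cong (λ b → if b then [ [] ] else []) (p≗p′ [])
    enum-cong p≗p′ zero (suc m) = refl
    enum-cong p≗p′ (suc n) m = enumUpTo-cong p≗p′ n m m

    enumUpTo-cong : ∀ {p p′} → (∀ w → p w ≡ p′ w) → ∀ n m j → enumUpTo p n m j ≡ enumUpTo p′ n m j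
    enumUpTo-cong p≗p′ n m zero = refl
    enumUpTo-cong p≗p′ n m (suc j) =
      ≡.cong₂ _++_ (enumUpTo-cong p≗p′ n m j)
                   (≡.cong (map (suc j ∷_)) (enum-cong (λ w → p≗p′ (suc j ∷ w)) n (m ∸ suc j)))

  mutual
    enum-empty : ∀ {p} → (∀ w → p w ≡ false) → ∀ n m → enum p n m ≡ []
    enum-empty p≡false zero zero rewrite p≡false [] = refl
    enum-empty p≡false zero (suc m) = refl
    enum-empty p≡false (suc n) m = enumUpTo-empty (λ a w → p≡false (suc a ∷ w)) n m m

    enumUpTo-empty : ∀ {p} → (∀ a w → p (suc a ∷ w) ≡ false) → ∀ n m j → enumUpTo p n m j ≡ []
    enumUpTo-empty p≡false n m zero = refl
    enumUpTo-empty p≡false n m (suc j) =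
      ≡.cong₂ (λ xs ys → xs ++ map (suc j ∷_) ys) (enumUpTo-empty p≡false n m j) (enum-empty (p≡false j) n (m ∸ suc j))


module BivariateSeries where
  open import Level using (0ℓ)
  open import Relation.Binary.PropositionalEquality using (refl)
  open Enumeration

  module ℤ[[x]] = PowerSeries ℤ.+-*-commutativeRing
  module ℤ[[x]][[t]] = PowerSeries ℤ[[x]].powerSeriesRing

  SeriesRing : CommutativeRing 0ℓ 0ℓ
  SeriesRing = ℤ[[x]][[t]].powerSeriesRing

  open CommutativeRing SeriesRing using (_≈_; _+_; _*_; _-_; 1#)
    renaming (refl to ≈-refl; sym to ≈-sym; trans to ≈-trans; *-congˡ to *-≈ˡ)
  open import Algebra.Properties.Semiring.Exp (CommutativeRing.semiring SeriesRing) using (_^_)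
  open RingRecurrences SeriesRing using (∑<)

  sumTo≡∑≤ : ∀ n f → sumTo n f ≡ ℤ[[x]].∑≤ n f
  sumTo≡∑≤ zero f = refl
  sumTo≡∑≤ (suc n) f = ≡.cong (ℤ._+ f (suc n)) (sumTo≡∑≤ n f)

  sumTo-cong : ∀ n {F G} → (∀ i → F i ≡ G i) → sumTo n F ≡ sumTo n G
  sumTo-cong n {F} {G} F≗G =
    ≡.trans (sumTo≡∑≤ n F) (≡.trans (ℤ[[x]].∑≤-cong n (λ i _ → F≗G i)) (≡.sym (sumTo≡∑≤ n G)))

  sumTo-+ : ∀ n F G → sumTo n (λ i → F i ℤ.+ G i) ≡ sumTo n F ℤ.+ sumTo n G
  sumTo-+ n F G = ≡.trans (sumTo≡∑≤ n _)
    (≡.trans (ℤ[[x]].∑≤-+ n F G) (≡.sym (≡.cong₂ ℤ._+_ (sumTo≡∑≤ n F) (sumTo≡∑≤ n G))))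

  ∑≤-at : ∀ n F m → ℤ[[x]][[t]].∑≤ n F m ≡ sumTo n (λ i → F i m)
  ∑≤-at zero F m = refl
  ∑≤-at (suc n) F m = ≡.cong (ℤ._+ F (suc n) m) (∑≤-at n F m)

  ⊗≡* : ∀ f g n m → (f ⊗ g) n m ≡ (f * g) n m
  ⊗≡* f g n m = ≡.sym (≡.trans (∑≤-at n _ m) (sumTo-cong n λ i → ≡.sym (sumTo≡∑≤ m _)))

  ⊗-≈ : ∀ {f f′ g g′} → f ≈ f′ → g ≈ g′ → (f ⊗ g) ≈ (f′ * g′)
  ⊗-≈ {f} {f′} {g} {g′} f≈f′ g≈g′ n m = ≡.trans (⊗≡* f g n m) (CommutativeRing.*-cong SeriesRing f≈f′ g≈g′ n m)

  ⊕-≈ : ∀ {f f′ g g′} → f ≈ f′ → g ≈ g′ → (f ⊕ g) ≈ (f′ + g′)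
  ⊕-≈ f≈f′ g≈g′ n m = ≡.cong₂ ℤ._+_ (f≈f′ n m) (g≈g′ n m)

  ⊖-≈ : ∀ {f f′ g g′} → f ≈ f′ → g ≈ g′ → (f ⊖ g) ≈ (f′ - g′)
  ⊖-≈ f≈f′ g≈g′ n m = ≡.cong₂ ℤ._-_ (f≈f′ n m) (g≈g′ n m)

  mono-same : ∀ a c → mono a c a c ≡ + 1
  mono-same a c with a ℕ.≟ a | c ℕ.≟ c
  ... | yes _ | yes _ = refl
  ... | no a≢a | _ = contradiction refl a≢a
  ... | yes _ | no c≢c = contradiction refl c≢c

  mono-≢ᵗ : ∀ {a n} c m → a ≢ n → mono a c n m ≡ + 0
  mono-≢ᵗ {a} {n} c m a≢n with a ℕ.≟ n | c ℕ.≟ m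
  ... | yes a≡n | _ = contradiction a≡n a≢n
  ... | no _ | yes _ = refl
  ... | no _ | no _ = refl

  mono-≢ˣ : ∀ a n {c m} → c ≢ m → mono a c n m ≡ + 0
  mono-≢ˣ a n {c} {m} c≢m with a ℕ.≟ n | c ℕ.≟ m
  ... | _ | yes c≡m = contradiction c≡m c≢m
  ... | yes _ | no _ = refl
  ... | no _ | no _ = refl

  private
    annihilate : ∀ {x y} → x ≡ + 0 → x ℤ.* y ≡ + 0
    annihilate refl = refl

    row : ℕ → ℕ → Series → ℕ → ℕ → ℕ → ℤ
    row a c F n m i = sumTo m (λ j → mono a c i j ℤ.* F (n ∸ i) (m ∸ j))

    row-≢ : ∀ a c F n m {i} → i ≢ a → row a c F n m i ≡ + 0
    row-≢ a c F n m {i} i≢a =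
      ≡.trans (sumTo≡∑≤ m (λ j → mono a c i j ℤ.* F (n ∸ i) (m ∸ j)))
              (ℤ[[x]].∑≤-zero m λ j _ → annihilate (mono-≢ᵗ c j (≡.≢-sym i≢a)))

  mono-⊗ : ∀ {a c} F {n m} → a ≤ n → c ≤ m → (mono a c ⊗ F) n m ≡ F (n ∸ a) (m ∸ c)
  mono-⊗ {a} {c} F {n} {m} a≤n c≤m = begin
    (mono a c ⊗ F) n m                                        ≡⟨ sumTo≡∑≤ n (row a c F n m) ⟩
    ℤ[[x]].∑≤ n (row a c F n m)                               ≡⟨ ℤ[[x]].∑≤-single n a a≤n (λ i _ → row-≢ a c F n m) ⟩
    row a c F n m a                                           ≡⟨ sumTo≡∑≤ m (λ j → mono a c a j ℤ.* F (n ∸ a) (m ∸ j)) ⟩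
    ℤ[[x]].∑≤ m (λ j → mono a c a j ℤ.* F (n ∸ a) (m ∸ j))
      ≡⟨ ℤ[[x]].∑≤-single m c c≤m (λ j _ j≢c → annihilate (mono-≢ˣ a a (≡.≢-sym j≢c))) ⟩
    mono a c a c ℤ.* F (n ∸ a) (m ∸ c)                        ≡⟨ ≡.cong (ℤ._* F (n ∸ a) (m ∸ c)) (mono-same a c) ⟩
    + 1 ℤ.* F (n ∸ a) (m ∸ c)                                 ≡⟨ ℤ.*-identityˡ _ ⟩
    F (n ∸ a) (m ∸ c)                                         ∎
    where open ≡.≡-Reasoning

  mono-⊗-<ᵗ : ∀ {a c} F {n m} → n < a → (mono a c ⊗ F) n m ≡ + 0
  mono-⊗-<ᵗ {a} {c} F {n} {m} n<a =
    ≡.trans (sumTo≡∑≤ n (row a c F n m)) (ℤ[[x]].∑≤-zero n λ i i≤n → row-≢ a c F n m (ℕ.<⇒≢ (ℕ.≤-<-trans i≤n n<a)))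

  mono-⊗-<ˣ : ∀ {a c} F {n m} → m < c → (mono a c ⊗ F) n m ≡ + 0
  mono-⊗-<ˣ {a} {c} F {n} {m} m<c =
    ≡.trans (sumTo≡∑≤ n (row a c F n m)) (ℤ[[x]].∑≤-zero n λ i _ →
      ≡.trans (sumTo≡∑≤ m (λ j → mono a c i j ℤ.* F (n ∸ i) (m ∸ j)))
              (ℤ[[x]].∑≤-zero m λ j j≤m → annihilate (mono-≢ˣ a i (≡.≢-sym (ℕ.<⇒≢ (ℕ.≤-<-trans j≤m m<c))))))

  mono-shift : ∀ {a c a′ c′ n m} → a ≤ n → c ≤ m → mono a′ c′ (n ∸ a) (m ∸ c) ≡ mono (a ℕ.+ a′) (c ℕ.+ c′) n m
  mono-shift {a} {c} {a′} {c′} {n} {m} a≤n c≤m = by-cases (a′ ℕ.≟ n ∸ a) (c′ ℕ.≟ m ∸ c)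
    where
    unshift : ∀ {a a′ n} → a ℕ.+ a′ ≡ n → a′ ≡ n ∸ a
    unshift {a} refl = ≡.sym (ℕ.m+n∸m≡n a _)
    shift : ∀ {a a′ n} → a ≤ n → a′ ≡ n ∸ a → a ℕ.+ a′ ≡ n
    shift a≤n refl = ℕ.m+[n∸m]≡n a≤n
    by-cases : _ → _ → mono a′ c′ (n ∸ a) (m ∸ c) ≡ mono (a ℕ.+ a′) (c ℕ.+ c′) n m
    by-cases (yes a′≡) (yes c′≡) = ≡.trans (≡.subst₂ (λ u v → mono a′ c′ u v ≡ + 1) a′≡ c′≡ (mono-same a′ c′))
      (≡.sym (≡.subst₂ (λ u v → mono (a ℕ.+ a′) (c ℕ.+ c′) u v ≡ + 1) (shift a≤n a′≡) (shift c≤m c′≡) (mono-same _ _)))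
    by-cases (no a′≢) _ = ≡.trans (mono-≢ᵗ c′ (m ∸ c) a′≢) (≡.sym (mono-≢ᵗ (c ℕ.+ c′) m λ eq → a′≢ (unshift eq)))
    by-cases (yes _) (no c′≢) = ≡.trans (mono-≢ˣ a′ (n ∸ a) c′≢) (≡.sym (mono-≢ˣ (a ℕ.+ a′) n λ eq → c′≢ (unshift eq)))

  mono-suc : ∀ a c n m → mono a (suc c) n (suc m) ≡ mono a c n m
  mono-suc a c n m with a ℕ.≟ n | suc c ℕ.≟ suc m | c ℕ.≟ m
  ... | yes _ | yes _ | yes _ = refl
  ... | yes _ | yes 1+c≡1+m | no c≢m = contradiction (ℕ.suc-injective 1+c≡1+m) c≢m
  ... | yes _ | no 1+c≢1+m | yes c≡m = contradiction (≡.cong suc c≡m) 1+c≢1+m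
  ... | yes _ | no _ | no _ = refl
  ... | no _ | _ | _ = refl

  mono-* : ∀ a c a′ c′ → (mono a c * mono a′ c′) ≈ mono (a ℕ.+ a′) (c ℕ.+ c′)
  mono-* a c a′ c′ n m = ≡.trans (≡.sym (⊗≡* (mono a c) (mono a′ c′) n m)) (product (a ℕ.≤? n) (c ℕ.≤? m))
    where
    product : _ → _ → (mono a c ⊗ mono a′ c′) n m ≡ mono (a ℕ.+ a′) (c ℕ.+ c′) n m
    product (yes a≤n) (yes c≤m) = ≡.trans (mono-⊗ {a} {c} (mono a′ c′) {n} {m} a≤n c≤m) (mono-shift a≤n c≤m)
    product (no a≰n) _ = ≡.trans (mono-⊗-<ᵗ {a} {c} (mono a′ c′) {n} {m} (ℕ.≰⇒> a≰n))
      (≡.sym (mono-≢ᵗ (c ℕ.+ c′) m λ eq → a≰n (≡.subst (a ≤_) eq (ℕ.m≤m+n a a′))))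
    product (yes _) (no c≰m) = ≡.trans (mono-⊗-<ˣ {a} {c} (mono a′ c′) {n} {m} (ℕ.≰⇒> c≰m))
      (≡.sym (mono-≢ˣ (a ℕ.+ a′) n λ eq → c≰m (≡.subst (c ≤_) eq (ℕ.m≤m+n c c′))))

  mono-cong : ∀ {a a′ c c′} → a ≡ a′ → c ≡ c′ → mono a c ≈ mono a′ c′
  mono-cong refl refl = ≈-refl

  1≈mono : 1# ≈ mono 0 0
  1≈mono zero zero = ≡.sym (mono-same 0 0)
  1≈mono zero (suc m) = ≡.sym (mono-≢ˣ 0 0 {0} {suc m} λ ())
  1≈mono (suc n) m = ≡.sym (mono-≢ᵗ {0} {suc n} 0 m λ ())

  mono-^ : ∀ a c j → mono a c ^ j ≈ mono (j ℕ.* a) (j ℕ.* c)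
  mono-^ a c zero = 1≈mono
  mono-^ a c (suc j) = ≈-trans (*-≈ˡ {mono a c} (mono-^ a c j)) (mono-* a c (j ℕ.* a) (j ℕ.* c))

  ^S-≈ : ∀ {f f′} → f ≈ f′ → ∀ j → (f ^S j) ≈ f′ ^ j
  ^S-≈ f≈f′ zero = ≈-sym 1≈mono
  ^S-≈ f≈f′ (suc j) = ⊗-≈ f≈f′ (^S-≈ f≈f′ j)

  sumS-≈ : ∀ n {F G} → (∀ i → F i ≈ G i) → sumS n F ≈ ∑< n G
  sumS-≈ zero F≈G = ≈-refl
  sumS-≈ (suc n) F≈G = ⊕-≈ (sumS-≈ n F≈G) (F≈G n)

  x^≈mono : ∀ j → xS ^ j ≈ mono 0 j
  x^≈mono j = ≈-trans (mono-^ 0 1 j) (mono-cong (ℕ.*-zeroʳ j) (ℕ.*-identityʳ j))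

  t*x^≈mono : ∀ j → tS * xS ^ j ≈ mono 1 j
  t*x^≈mono j = ≈-trans (*-≈ˡ {tS} (x^≈mono j)) (mono-* 1 0 0 j)

  x*-zero : ∀ F n → (xS * F) n 0 ≡ + 0
  x*-zero F n = ≡.trans (≡.sym (⊗≡* xS F n 0)) (mono-⊗-<ˣ {0} {1} F {n} (s≤s z≤n))

  x*-suc : ∀ F n m → (xS * F) n (suc m) ≡ F n m
  x*-suc F n m = ≡.trans (≡.sym (⊗≡* xS F n (suc m))) (mono-⊗ {0} {1} F {n} z≤n (s≤s z≤n))

  above : ℕ → Series
  above b zero a = + 0
  above b (suc zero) a = if b <ᵇ a then + 1 else + 0
  above b (suc (suc n)) a = + 0

  above-step : ∀ b m → above b 1 (suc m) ℤ.- above b 1 m ≡ mono 1 (suc b) 1 (suc m)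
  above-step zero zero = ≡.sym (mono-same 1 1)
  above-step zero (suc m) = ≡.sym (mono-≢ˣ 1 1 {1} {suc (suc m)} λ ())
  above-step (suc b) zero = ≡.sym (mono-≢ˣ 1 1 {suc (suc b)} {1} λ ())
  above-step (suc b) (suc m) = ≡.trans (above-step b m) (≡.sym (mono-suc 1 (suc b) 1 (suc m)))

  [1-x]*above : ∀ b → (1# - xS) * above b ≈ tS * xS ^ suc b
  [1-x]*above b = ≈-trans (solve 2 (λ x L → (:1 :- x) :* L := L :- x :* L) ≈-refl xS (above b))
                          (≈-trans difference (≈-sym (t*x^≈mono (suc b))))
    where
    open IntegerRingSolver SeriesRing using (solve; _:=_; _:-_; _:*_; :1)
    difference : (above b - xS * above b) ≈ mono 1 (suc b)
    difference n zero rewrite x*-zero (above b) n = ≡.trans (no-letter-0 n) (≡.sym (mono-≢ˣ 1 n {suc b} λ ()))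
      where
      no-letter-0 : ∀ n → above b n 0 ℤ.- + 0 ≡ + 0
      no-letter-0 zero = refl
      no-letter-0 (suc zero) = refl
      no-letter-0 (suc (suc n)) = refl
    difference n (suc m) rewrite x*-suc (above b) n m = by-degree n
      where
      by-degree : ∀ n → above b n (suc m) ℤ.- above b n m ≡ mono 1 (suc b) n (suc m)
      by-degree zero = ≡.sym (mono-≢ᵗ {1} {0} (suc b) (suc m) λ ())
      by-degree (suc zero) = above-step b m
      by-degree (suc (suc n)) = ≡.sym (mono-≢ᵗ {1} {suc (suc n)} (suc b) (suc m) λ ())

  gf : (Word → Bool) → Series
  gf p n m = + length (enum p n m)

  length-enumUpTo : ∀ p n m j → + length (enumUpTo p n m j) ≡ sumTo j (λ i → + length (enumHead p n m i))
  length-enumUpTo p n m zero = refl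
  length-enumUpTo p n m (suc j) =
    ≡.trans (≡.cong +_ (List.length-++ (enumUpTo p n m j)))
            (≡.cong (ℤ._+ + length (enumHead p n m (suc j))) (length-enumUpTo p n m j))

  TLinear : Series → Set
  TLinear L = ∀ i j → i ≢ 1 → L i j ≡ + 0

  t-linear-⊗ : ∀ L F → TLinear L → ∀ n m → (L ⊗ F) (suc n) m ≡ sumTo m (λ j → L 1 j ℤ.* F n (m ∸ j))
  t-linear-⊗ L F L≡0 n m = ≡.trans (sumTo≡∑≤ (suc n) _) (ℤ[[x]].∑≤-single (suc n) 1 (s≤s z≤n) λ i _ i≢1 →
    ≡.trans (sumTo≡∑≤ m (λ j → L i j ℤ.* F (suc n ∸ i) (m ∸ j)))
            (ℤ[[x]].∑≤-zero m λ j _ → ≡.cong (ℤ._* F (suc n ∸ i) (m ∸ j)) (L≡0 i j i≢1)))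

  t-linear-⊗-0 : ∀ L F → TLinear L → ∀ m → (L ⊗ F) 0 m ≡ + 0
  t-linear-⊗-0 L F L≡0 m = ≡.trans (sumTo≡∑≤ m (λ j → L 0 j ℤ.* F 0 (m ∸ j)))
    (ℤ[[x]].∑≤-zero m λ j _ → ≡.cong (ℤ._* F 0 (m ∸ j)) (L≡0 0 j λ ()))

  above-t-linear : ∀ b → TLinear (above b)
  above-t-linear b zero j _ = refl
  above-t-linear b (suc zero) j 1≢1 = contradiction refl 1≢1
  above-t-linear b (suc (suc i)) j _ = refl

  gf-split : ∀ b {p p₁ p₂} → p [] ≡ false → (∀ a w → p (suc a ∷ w) ≡ (if b <ᵇ suc a then p₂ w else p₁ w)) →
             gf p ≈ (above 0 - above b) * gf p₁ + above b * gf p₂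
  gf-split b {p} {p₁} {p₂} p[]≡false p-step = coefficients
    where
    L₁ L₂ : Series
    L₁ = above 0 - above b
    L₂ = above b
    L₁-t-linear : TLinear L₁
    L₁-t-linear i j i≢1 = ≡.cong₂ (λ u v → u ℤ.- v) (above-t-linear 0 i j i≢1) (above-t-linear b i j i≢1)
    count-first-letter : ∀ {n m a c} → (b <ᵇ suc a) ≡ c →
                         + length (enumHead p n m (suc a)) ≡ gf (λ w → if c then p₂ w else p₁ w) n (m ∸ suc a)
    count-first-letter {n} {m} {a} eq = ≡.trans
      (≡.cong +_ (List.length-map (suc a ∷_) (enum (λ w → p (suc a ∷ w)) n (m ∸ suc a))))
      (≡.cong (λ ws → + length ws)
              (enum-cong (λ w → ≡.trans (p-step a w) (≡.cong (λ c → if c then p₂ w else p₁ w) eq)) n (m ∸ suc a)))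
    first-letter : ∀ n m j → + length (enumHead p n m j) ≡ L₁ 1 j ℤ.* gf p₁ n (m ∸ j) ℤ.+ L₂ 1 j ℤ.* gf p₂ n (m ∸ j)
    first-letter n m zero = refl
    first-letter n m (suc a) with b <ᵇ suc a in b<1+a
    ... | true = ≡.trans (count-first-letter {n} {m} {a} b<1+a) (≡.sym (≡.trans (ℤ.+-identityˡ _) (ℤ.*-identityˡ _)))
    ... | false = ≡.trans (count-first-letter {n} {m} {a} b<1+a) (≡.sym (≡.trans (ℤ.+-identityʳ _) (ℤ.*-identityˡ _)))
    coefficients : gf p ≈ L₁ * gf p₁ + L₂ * gf p₂
    coefficients zero m = ≡.trans (empty-word m) (≡.sym (≡.cong₂ ℤ._+_
      (≡.trans (≡.sym (⊗≡* L₁ (gf p₁) 0 m)) (t-linear-⊗-0 L₁ (gf p₁) L₁-t-linear m))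
      (≡.trans (≡.sym (⊗≡* L₂ (gf p₂) 0 m)) (t-linear-⊗-0 L₂ (gf p₂) (above-t-linear b) m))))
      where
      empty-word : ∀ m → gf p 0 m ≡ + 0
      empty-word zero rewrite p[]≡false = refl
      empty-word (suc m) = refl
    coefficients (suc n) m = begin
      + length (enumUpTo p n m m)                              ≡⟨ length-enumUpTo p n m m ⟩
      sumTo m (λ j → + length (enumHead p n m j))              ≡⟨ sumTo-cong m (first-letter n m) ⟩
      sumTo m (λ j → L₁ 1 j ℤ.* gf p₁ n (m ∸ j) ℤ.+ L₂ 1 j ℤ.* gf p₂ n (m ∸ j))  ≡⟨ sumTo-+ m _ _ ⟩
      sumTo m (λ j → L₁ 1 j ℤ.* gf p₁ n (m ∸ j)) ℤ.+ sumTo m (λ j → L₂ 1 j ℤ.* gf p₂ n (m ∸ j))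
        ≡⟨ ≡.sym (≡.cong₂ ℤ._+_ (t-linear-⊗ L₁ (gf p₁) L₁-t-linear n m) (t-linear-⊗ L₂ (gf p₂) (above-t-linear b) n m)) ⟩
      (L₁ ⊗ gf p₁) (suc n) m ℤ.+ (L₂ ⊗ gf p₂) (suc n) m
        ≡⟨ ≡.cong₂ ℤ._+_ (⊗≡* L₁ (gf p₁) (suc n) m) (⊗≡* L₂ (gf p₂) (suc n) m) ⟩
      (L₁ * gf p₁ + L₂ * gf p₂) (suc n) m                      ∎
      where open ≡.≡-Reasoning

  gf-only-[] : ∀ {p} → p [] ≡ true → (∀ a w → p (suc a ∷ w) ≡ false) → gf p ≈ 1#
  gf-only-[] p[]≡true p-step zero zero rewrite p[]≡true = refl
  gf-only-[] p[]≡true p-step zero (suc m) = refl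
  gf-only-[] p[]≡true p-step (suc n) m = ≡.cong (λ ws → + length ws) (enumUpTo-empty p-step n m m)


module SeriesOf𝒮 (l b′ : ℕ) where
  open Enumeration
  open BivariateSeries
  open CommutativeRing SeriesRing using (_≈_; _*_; 1#; *-identityʳ)
    renaming (refl to ≈-refl; sym to ≈-sym; trans to ≈-trans; *-cong to *-≈; *-congˡ to *-≈ˡ)
  open import Algebra.Properties.Semiring.Exp (CommutativeRing.semiring SeriesRing) using (_^_; ^-congˡ)
  open RingRecurrences SeriesRing using (homogeneous-∑<; module GeneratingFunction)
  open GeneratingFunction xS tS b′ l public
  open BlockAutomaton (suc b′) (suc l) public

  denom≈ : ∀ k → denom k (suc l) (suc b′) ≈ y ^ suc k * denominator
  denom≈ k = ⊗-≈ (≡.subst (λ e → ((oneS ⊖ xS) ^S e) ≈ y ^ suc k) (ℕ.+-comm 1 k) (^S-≈ y≈ (suc k)))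
                 (⊕-≈ (⊗-≈ (^S-≈ q≈ l) (⊖-≈ oneS≈ (⊗-≈ tx≈ (sumS-≈ b′ λ j → ^S-≈ {xS} ≈-refl j))))
                      (⊗-≈ (⊖-≈ y≈ tx≈)
                           (≈-trans (sumS-≈ l λ i → ⊗-≈ (^S-≈ y≈ i) (^S-≈ q≈ (l ∸ 1 ∸ i))) (≈-sym (homogeneous-∑< y q l)))))
    where
    oneS≈ : oneS ≈ 1#
    oneS≈ = ≈-sym 1≈mono
    y≈ : (oneS ⊖ xS) ≈ y
    y≈ = ⊖-≈ {g = xS} oneS≈ ≈-refl
    q≈ : (tS ⊗ (xS ^S suc b′)) ≈ q
    q≈ = ⊗-≈ {tS} ≈-refl (^S-≈ {xS} ≈-refl (suc b′))
    tx≈ : (tS ⊗ xS) ≈ tS * xS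
    tx≈ = ⊗-≈ {tS} {tS} {xS} ≈-refl ≈-refl

  numer≈ : ∀ k → (tS * xS) ^ k * q ^ suc l ≈ numer k (suc l) (suc b′)
  numer≈ k = ≈-trans (*-≈ (≈-trans (^-congˡ k (mono-* 1 0 0 1)) (mono-^ 1 1 k))
                          (≈-trans (^-congˡ (suc l) (t*x^≈mono (suc b′))) (mono-^ 1 (suc b′) (suc l))))
             (≈-trans (mono-* (k ℕ.* 1) (k ℕ.* 1) (suc l ℕ.* 1) (suc l ℕ.* suc b′))
                      (mono-cong (≡.cong₂ ℕ._+_ (ℕ.*-identityʳ k) (ℕ.*-identityʳ (suc l)))
                                 (≡.cong₂ ℕ._+_ (ℕ.*-identityʳ k) (ℕ.*-comm (suc l) (suc b′)))))

  gf-identity : ∀ k → gf (acceptsAfter k) * (y ^ suc k * denominator) ≈ (tS * xS) ^ k * q ^ suc l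
  gf-identity = generating-function-identity (above 0) (above b′) (λ r → gf (accepts r)) (λ k → gf (acceptsAfter k))
    (≈-trans ([1-x]*above 0) (*-≈ˡ {tS} (*-identityʳ xS)))
    ([1-x]*above b′)
    (gf-only-[] ≡.refl λ _ _ → ≡.refl)
    (λ r → gf-split b′ ≡.refl λ _ _ → ≡.refl)
    ≈-refl
    (λ k → ≈-trans (gf-split 0 ≡.refl λ _ _ → ≡.refl)
                   (solve 2 (λ a u → (a :- a) :* u :+ a :* u := a :* u) ≈-refl (above 0) (gf (acceptsAfter k))))
    where open IntegerRingSolver SeriesRing using (solve; _:=_; _:+_; _:-_; _:*_)

  count≡length-enum : ∀ k (c : ℕ → ℕ → ℕ) →
    (∀ n m → IsCount (λ w → Positive w × InS (oneKbL k (suc b′) (suc l)) w × length w ≡ n × sum w ≡ m) (c n m)) →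
    ∀ n m → c n m ≡ length (enum (acceptsAfter k) n m)
  count≡length-enum k c isCount n m = IsCount-unique
    (λ w → mk⇔ (λ (pos , inS , rest) → pos , Equivalence.to (InS-oneKbL k pos) inS , rest)
               (λ (pos , acc , rest) → pos , Equivalence.from (InS-oneKbL k pos) acc , rest))
    (isCount n m) (enum-isCount (acceptsAfter k) n m)

theorem6p2 : (k ℓ b : ℕ) → 1 ≤ ℓ → 2 ≤ b →
    (c : ℕ → ℕ → ℕ) →
    (∀ n m → IsCount (λ w → Positive w × InS (oneKbL k b ℓ) w × length w ≡ n × sum w ≡ m) (c n m)) →
    ∀ n m → ((λ i j → + c i j) ⊗ denom k ℓ b) n m ≡ numer k ℓ b n m
theorem6p2 k zero b () _ _ _ _ _
theorem6p2 k (suc l) zero _ () _ _ _ _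
theorem6p2 k (suc l) (suc b′) _ _ c isCount n m = begin
  ((λ i j → + c i j) ⊗ denom k (suc l) (suc b′)) n m
    ≡⟨ ⊗-≈ (λ i j → ≡.cong +_ (count≡length-enum k c isCount i j)) (denom≈ k) n m ⟩
  (gf (acceptsAfter k) * (y ^ suc k * denominator)) n m
    ≡⟨ gf-identity k n m ⟩
  ((tS * xS) ^ k * q ^ suc l) n m
    ≡⟨ numer≈ k n m ⟩
  numer k (suc l) (suc b′) n m ∎
  where
  open ≡.≡-Reasoning
  open BivariateSeries using (SeriesRing; ⊗-≈; gf)
  open CommutativeRing SeriesRing using (_*_)
  open import Algebra.Properties.Semiring.Exp (CommutativeRing.semiring SeriesRing) using (_^_)
  open SeriesOf𝒮 l b′
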